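{- Let $Y$ be a robust $Y$-set parameter and let $G$ and $G'$ be graphs such that $\mathfrak{Y}(G)\cong\mathfrak{Y}(G')$. If $Y(K_1)=1$ or $G$ and $G'$ have no isolated vertices, then $G$ and $G'$ have the same order and there is a relabeling of the vertices of $G'$ such that $G$ and $G'$ have exactly the same $Y$-sets; that is, there is a bijection $\psi:V(G)\to V(G')$ such that for every $T\subseteq V(G)$, $T$ is a $Y$-set of $G$ iff $\psi(T)$ is a $Y$-set of $G'$.
   Context: All graphs are finite, simple, undirected, with nonempty vertex set. A vertex set property assigns to each graph $G$ a family of subsets of $V(G)$ (the $Y$-sets of $G$), invariant under graph isomorphism; it is cohesive if every graph has at least one $Y$-set. A robust $Y$-set parameter is a cohesive vertex set property satisfying: (Subset) if $T$ is a $Y$-set of $G$ and $T'\subseteq T$ then $T'$ is a $Y$-set; (Singletons) if $G$ is connected of order at least two, every one-vertex set $\{v\}$, $v\in V(G)$, is a $Y$-set; (Component consistency) if $G_1,\dots,G_k$ are the connected components of $G$, then $T$ is a $Y$-set of $G$ iff $T\cap V(G_i)$ is a $Y$-set of $G_i$ for every $i$. $Y(G)$ is the maximum cardinality of a $Y$-set of $G$ and $Y(K_1)$ its value on the one-vertex graph. The $Y$-TAR graph $\mathfrak{Y}(G)$ has as vertices the $Y$-sets of $G$, with $T_1,T_2$ adjacent iff $|T_1\ominus T_2|=1$. -}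

module Defs where

open import Data.Nat using (ℕ; suc; _≤_)
open import Data.Bool using (Bool; true; false; _xor_)
open import Data.Fin using (Fin; zero)
open import Data.Fin.Subset using (Subset; ∣_∣; _⊆_; ⁅_⁆)
open import Data.Vec using (tabulate; lookup; zipWith)
open import Data.Product using (Σ; ∃; _×_; _,_)
open import Relation.Binary.PropositionalEquality using (_≡_)
open import Function.Bundles using (_↔_; Inverse)
open import Function.Definitions using (Injective)

-- A finite simple graph on vertex set Fin n (Bool-valued adjacency,
-- symmetric and irreflexive).  Nonemptiness is imposed by only ever
-- quantifying over graphs of order (suc m).
record Graph (n : ℕ) : Set where
  field
    adj   : Fin n → Fin n → Bool
    sym   : ∀ u v → adj u v ≡ adj v u
    irrfl : ∀ v → adj v v ≡ false
open Graph public

K1 : Graph 1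
K1 = record { adj = λ _ _ → false ; sym = λ _ _ → _≡_.refl ; irrfl = λ _ → _≡_.refl }

data Reachable {n : ℕ} (G : Graph n) : Fin n → Fin n → Set where
  here : ∀ {v} → Reachable G v v
  step : ∀ {u w v} → adj G u w ≡ true → Reachable G w v → Reachable G u v

Connected : ∀ {n} → Graph n → Set
Connected G = ∀ u v → Reachable G u v

NoIsolated : ∀ {n} → Graph n → Set
NoIsolated {n} G = ∀ (v : Fin n) → ∃ λ u → adj G v u ≡ true

GraphIso : ∀ {n n'} → Graph n → Graph n' → (Fin n ↔ Fin n') → Set
GraphIso G G' σ = ∀ u v → adj G u v ≡ adj G' (Inverse.to σ u) (Inverse.to σ v)

image : ∀ {n n'} → (Fin n ↔ Fin n') → Subset n → Subset n'
image σ T = tabulate (λ j → lookup T (Inverse.from σ j))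

preimage : ∀ {k n} → (Fin k → Fin n) → Subset n → Subset k
preimage e T = tabulate (λ i → lookup T (e i))

VSP : Set
VSP = ∀ {n} → Graph n → Subset n → Bool

IsoInvariant : VSP → Set
IsoInvariant Y = ∀ {n n'} (G : Graph n) (G' : Graph n') (σ : Fin n ↔ Fin n') →
  GraphIso G G' σ → ∀ T → Y G T ≡ Y G' (image σ T)

Cohesive : VSP → Set
Cohesive Y = ∀ {m} (G : Graph (suc m)) → ∃ λ T → Y G T ≡ true

SubsetClosed : VSP → Set
SubsetClosed Y = ∀ {m} (G : Graph (suc m)) (T T' : Subset (suc m)) →
  Y G T ≡ true → T' ⊆ T → Y G T' ≡ true

Singletons : VSP → Set
Singletons Y = ∀ {m} (G : Graph (suc (suc m))) → Connected G →
  ∀ v → Y G ⁅ v ⁆ ≡ true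

-- e : Fin (suc k) → Fin n presents H as (an isomorphic copy of) a
-- connected component of G: e is injective, adjacency-preserving and
-- reflecting, H is connected, and the image is closed under G-adjacency.
IsComponent : ∀ {n k} → Graph n → Graph (suc k) → (Fin (suc k) → Fin n) → Set
IsComponent {n} {k} G H e =
  Injective _≡_ _≡_ e ×
  (∀ i j → adj H i j ≡ adj G (e i) (e j)) ×
  Connected H ×
  (∀ i (v : Fin n) → adj G (e i) v ≡ true → ∃ λ j → e j ≡ v)

ComponentConsistent : VSP → Set
ComponentConsistent Y = ∀ {m} (G : Graph (suc m)) (T : Subset (suc m)) →
  (Y G T ≡ true →
     ∀ k (H : Graph (suc k)) e → IsComponent G H e → Y H (preimage e T) ≡ true) ×
  ((∀ k (H : Graph (suc k)) e → IsComponent G H e → Y H (preimage e T) ≡ true) →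
     Y G T ≡ true)

record Robust (Y : VSP) : Set where
  field
    isoInv    : IsoInvariant Y
    cohesive  : Cohesive Y
    subsetCl  : SubsetClosed Y
    singleton : Singletons Y
    compCons  : ComponentConsistent Y

YValue : VSP → ∀ {n} → Graph n → ℕ → Set
YValue Y {n} G k =
  (∃ λ (T : Subset n) → Y G T ≡ true × ∣ T ∣ ≡ k) ×
  (∀ (T : Subset n) → Y G T ≡ true → ∣ T ∣ ≤ k)

YSet : VSP → ∀ {n} → Graph n → Set
YSet Y {n} G = Σ (Subset n) (λ T → Y G T ≡ true)

symDiff : ∀ {n} → Subset n → Subset n → Subset n
symDiff = zipWith _xor_

TARAdj : ∀ {Y : VSP} {n} {G : Graph n} → YSet Y G → YSet Y G → Set
TARAdj (T₁ , _) (T₂ , _) = ∣ symDiff T₁ T₂ ∣ ≡ 1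

TARIsomorphic : (Y : VSP) → ∀ {n n'} → Graph n → Graph n' → Set
TARIsomorphic Y G G' = Σ (YSet Y G ↔ YSet Y G') λ f →
  ∀ x y → (TARAdj {Y} x y → TARAdj {Y} (Inverse.to f x) (Inverse.to f y)) ×
          (TARAdj {Y} (Inverse.to f x) (Inverse.to f y) → TARAdj {Y} x y)

-- The Y-sets of a graph form a simplicial complex: a down-closed family containing ∅ and every
-- singleton (for a one-vertex component this is where Y(K₁) = 1 or the absence of isolated vertices
-- is needed), and the theorem holds for any isomorphism f of the TAR graphs of two simplicial
-- complexes. The TAR-neighbours of ∅ include all singletons, so f ⁅ v ⁆ = f ∅ ⊕ ⁅ ψ v ⁆ for an
-- injective ψ; doing the same for f⁻¹ shows the orders agree, so ψ is a bijection. By induction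
-- on |T|, f T = f ∅ ⊕ ψ(T): for distinct x, y ∈ T the edges from T to T ∖ x and to T ∖ y change
-- f T in single coordinates, and if the first were not ψ x it would have to be ψ y, which forces
-- f T = f (T ∖ {x, y}). Finally down-closure removes the translation by A = f ∅, because
-- ψ(T) ⊆ A ⊕ ψ(T ∖ ψ⁻¹(A)).
module Submission where

open import Defs hiding (sym)
open import Data.Nat using (ℕ; suc; zero; _<_)
open import Data.Nat.Properties using (<-trans; n≮0; n<1⇒n≡0; 1+n≰n)
open import Data.Nat.Induction using (<-wellFounded)
open import Induction.WellFounded using (Acc; acc)
open import Data.Bool using (Bool; true; false; not; _xor_; _∧_)
open import Data.Bool.Properties
  using (xor-assoc; xor-comm; xor-identityˡ; xor-identityʳ; xor-same; xor-inverseʳ; ¬-not)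
open import Data.Fin using (Fin; zero; suc; punchOut; _≟_)
open import Data.Fin.Properties using (any?; cantor-schröder-bernstein; punchOut-injective; injective⇒≤)
open import Data.Fin.Subset using (Subset; ∣_∣; _⊆_; ⁅_⁆; ⊥; _∈_; _∉_; _∩_; ∁; Empty)
open import Data.Fin.Subset.Properties
  using (x∈⁅x⁆; x∈⁅y⁆⇒x≡y; x≢y⇒x∉⁅y⁆; ∣⁅x⁆∣≡1; ⊥⊆; p⊂q⇒∣p∣<∣q∣; Empty-unique; ∣⊥∣≡0; nonempty?; p∩q⊆p)
open import Data.Vec using (Vec; lookup; tabulate; zipWith; map)
open import Data.Vec.Properties
  using ( lookup∘tabulate; tabulate∘lookup; tabulate-cong; lookup-zipWith; lookup-map; lookup-replicate
        ; []=⇒lookup; lookup⇒[]=; zipWith-assoc; zipWith-comm; zipWith-identityˡ; zipWith-identityʳ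
        ; zipWith-inverseˡ; map-id)
open import Data.Sum as Sum using (_⊎_; inj₁; inj₂)
open import Data.Product using (Σ; ∃; _×_; _,_; proj₁; proj₂)
open import Function using (_∘_; id)
open import Relation.Nullary using (yes; no; contradiction)
open import Relation.Binary.PropositionalEquality
  using (_≡_; _≢_; refl; sym; trans; cong; cong₂; subst; subst₂; module ≡-Reasoning)
open import Axiom.UniquenessOfIdentityProofs using (module Decidable⇒UIP)
open import Function.Bundles using (_↔_; Inverse; Injection; mk↔ₛ′)
open import Function.Definitions using (Injective)
open import Function.Properties.Inverse using (↔⇒↣)
open import Function.Construct.Symmetry using (↔-sym)
open import Function.Construct.Identity using (↔-id)

open ≡-Reasoning

private
  variable
    n k : ℕ

Bool-≡ : ∀ {a b : Bool} → (a ≡ true → b ≡ true) → (b ≡ true → a ≡ true) → a ≡ b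
Bool-≡ {true}  {true}  _ _ = refl
Bool-≡ {true}  {false} f _ = sym (f refl)
Bool-≡ {false} {true}  _ g = g refl
Bool-≡ {false} {false} _ _ = refl

lookup-injective : ∀ {A : Set} {p q : Vec A n} → (∀ i → lookup p i ≡ lookup q i) → p ≡ q
lookup-injective {p = p} {q} eq = begin
  p                  ≡⟨ tabulate∘lookup p ⟨
  tabulate (lookup p) ≡⟨ tabulate-cong eq ⟩
  tabulate (lookup q) ≡⟨ tabulate∘lookup q ⟩
  q                  ∎

infixl 6 _⊕_
_⊕_ : Subset n → Subset n → Subset n
_⊕_ = symDiff

⊕-assoc : (p q r : Subset n) → (p ⊕ q) ⊕ r ≡ p ⊕ (q ⊕ r)
⊕-assoc = zipWith-assoc xor-assoc

⊕-comm : (p q : Subset n) → p ⊕ q ≡ q ⊕ p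
⊕-comm = zipWith-comm xor-comm

⊕-identityˡ : (p : Subset n) → ⊥ ⊕ p ≡ p
⊕-identityˡ = zipWith-identityˡ xor-identityˡ

⊕-identityʳ : (p : Subset n) → p ⊕ ⊥ ≡ p
⊕-identityʳ = zipWith-identityʳ xor-identityʳ

⊕-self : (p : Subset n) → p ⊕ p ≡ ⊥
⊕-self p = trans (cong (_⊕ p) (sym (map-id p))) (zipWith-inverseˡ {⁻¹ = id} xor-same p)

p⊕[p⊕q]≡q : (p q : Subset n) → p ⊕ (p ⊕ q) ≡ q
p⊕[p⊕q]≡q p q = begin
  p ⊕ (p ⊕ q) ≡⟨ ⊕-assoc p p q ⟨
  p ⊕ p ⊕ q   ≡⟨ cong (_⊕ q) (⊕-self p) ⟩
  ⊥ ⊕ q       ≡⟨ ⊕-identityˡ q ⟩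
  q           ∎

[p⊕q]⊕q≡p : (p q : Subset n) → p ⊕ q ⊕ q ≡ p
[p⊕q]⊕q≡p p q = begin
  p ⊕ q ⊕ q   ≡⟨ ⊕-assoc p q q ⟩
  p ⊕ (q ⊕ q) ≡⟨ cong (p ⊕_) (⊕-self q) ⟩
  p ⊕ ⊥       ≡⟨ ⊕-identityʳ p ⟩
  p           ∎

⊕-cancelˡ : (p : Subset n) {q r : Subset n} → p ⊕ q ≡ p ⊕ r → q ≡ r
⊕-cancelˡ p {q} {r} eq = begin
  q           ≡⟨ p⊕[p⊕q]≡q p q ⟨
  p ⊕ (p ⊕ q) ≡⟨ cong (p ⊕_) eq ⟩
  p ⊕ (p ⊕ r) ≡⟨ p⊕[p⊕q]≡q p r ⟩
  r           ∎

p⊕q≡r⇒p≡q⊕r : {p q r : Subset n} → p ⊕ q ≡ r → p ≡ q ⊕ r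
p⊕q≡r⇒p≡q⊕r {p = p} {q} {r} eq = begin
  p         ≡⟨ [p⊕q]⊕q≡p p q ⟨
  p ⊕ q ⊕ q ≡⟨ cong (_⊕ q) eq ⟩
  r ⊕ q     ≡⟨ ⊕-comm r q ⟩
  q ⊕ r     ∎

p⊕q≡⊥⇒p≡q : {p q : Subset n} → p ⊕ q ≡ ⊥ → p ≡ q
p⊕q≡⊥⇒p≡q {q = q} eq = trans (p⊕q≡r⇒p≡q⊕r eq) (⊕-identityʳ q)

lookup-⊕ : (p q : Subset n) (i : Fin n) → lookup (p ⊕ q) i ≡ lookup p i xor lookup q i
lookup-⊕ p q i = lookup-zipWith _xor_ i p q

lookup⁅x⁆x≡true : (x : Fin n) → lookup ⁅ x ⁆ x ≡ true
lookup⁅x⁆x≡true x = []=⇒lookup (x∈⁅x⁆ x)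

x≢y⇒lookup⁅y⁆x≡false : {x y : Fin n} → x ≢ y → lookup ⁅ y ⁆ x ≡ false
x≢y⇒lookup⁅y⁆x≡false {x = x} {y} x≢y = ¬-not (x≢y⇒x∉⁅y⁆ x≢y ∘ lookup⇒[]= x ⁅ y ⁆)

⁅⁆-injective : {x y : Fin n} → ⁅ x ⁆ ≡ ⁅ y ⁆ → x ≡ y
⁅⁆-injective {x = x} {y} eq = x∈⁅y⁆⇒x≡y y (subst (x ∈_) eq (x∈⁅x⁆ x))

lookup-⊕⁅x⁆-≢ : (p : Subset n) {x y : Fin n} → y ≢ x → lookup (p ⊕ ⁅ x ⁆) y ≡ lookup p y
lookup-⊕⁅x⁆-≢ p {x} {y} y≢x = begin
  lookup (p ⊕ ⁅ x ⁆) y          ≡⟨ lookup-⊕ p ⁅ x ⁆ y ⟩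
  lookup p y xor lookup ⁅ x ⁆ y ≡⟨ cong (lookup p y xor_) (x≢y⇒lookup⁅y⁆x≡false y≢x) ⟩
  lookup p y xor false          ≡⟨ xor-identityʳ _ ⟩
  lookup p y                    ∎

x∉p⊕⁅x⁆ : {p : Subset n} {x : Fin n} → x ∈ p → x ∉ p ⊕ ⁅ x ⁆
x∉p⊕⁅x⁆ {p = p} {x} x∈p x∈p⊕x with () ← begin
  false                          ≡⟨⟩
  true xor true                  ≡⟨ cong₂ _xor_ ([]=⇒lookup x∈p) (lookup⁅x⁆x≡true x) ⟨
  lookup p x xor lookup ⁅ x ⁆ x  ≡⟨ lookup-⊕ p ⁅ x ⁆ x ⟨
  lookup (p ⊕ ⁅ x ⁆) x           ≡⟨ []=⇒lookup x∈p⊕x ⟩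
  true                           ∎

p⊕⁅x⁆⊆p : {p : Subset n} {x : Fin n} → x ∈ p → p ⊕ ⁅ x ⁆ ⊆ p
p⊕⁅x⁆⊆p {p = p} {x} x∈p {y} y∈p⊕x with y ≟ x
... | yes refl = x∈p
... | no y≢x   = lookup⇒[]= y p (trans (sym (lookup-⊕⁅x⁆-≢ p y≢x)) ([]=⇒lookup y∈p⊕x))

∣p⊕⁅x⁆∣<∣p∣ : {p : Subset n} {x : Fin n} → x ∈ p → ∣ p ⊕ ⁅ x ⁆ ∣ < ∣ p ∣
∣p⊕⁅x⁆∣<∣p∣ {x = x} x∈p = p⊂q⇒∣p∣<∣q∣ (p⊕⁅x⁆⊆p x∈p , x , x∈p , x∉p⊕⁅x⁆ x∈p)

∣p∣≡0⇒Empty : {p : Subset n} → ∣ p ∣ ≡ 0 → Empty p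
∣p∣≡0⇒Empty {p = p} ∣p∣≡0 (x , x∈p) = n≮0 (subst (∣ p ⊕ ⁅ x ⁆ ∣ <_) ∣p∣≡0 (∣p⊕⁅x⁆∣<∣p∣ x∈p))

∣p∣≡1⇒p≡⁅x⁆ : {p : Subset n} → ∣ p ∣ ≡ 1 → ∃ λ x → p ≡ ⁅ x ⁆
∣p∣≡1⇒p≡⁅x⁆ {n} {p} ∣p∣≡1 with nonempty? p
... | no p-empty with () ← trans (sym ∣p∣≡1) (trans (cong ∣_∣ (Empty-unique p-empty)) (∣⊥∣≡0 n))
... | yes (x , x∈p) = x , p⊕q≡⊥⇒p≡q (Empty-unique (∣p∣≡0⇒Empty ∣p⊕x∣≡0))
  where
  ∣p⊕x∣≡0 : ∣ p ⊕ ⁅ x ⁆ ∣ ≡ 0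
  ∣p⊕x∣≡0 = n<1⇒n≡0 (subst (∣ p ⊕ ⁅ x ⁆ ∣ <_) ∣p∣≡1 (∣p⊕⁅x⁆∣<∣p∣ x∈p))

singleton-exchange : (p : Subset n) {u w a b : Fin n} → u ≢ w → a ≢ u →
                     p ⊕ ⁅ u ⁆ ⊕ ⁅ a ⁆ ≡ p ⊕ ⁅ w ⁆ ⊕ ⁅ b ⁆ → a ≡ w
singleton-exchange p {u} {w} {a} {b} u≢w a≢u eq = ⁅⁆-injective (⊕-cancelˡ ⁅ u ⁆ (begin
  ⁅ u ⁆ ⊕ ⁅ a ⁆ ≡⟨ uw≡wb ⟩
  ⁅ w ⁆ ⊕ ⁅ b ⁆ ≡⟨ cong (λ z → ⁅ w ⁆ ⊕ ⁅ z ⁆) u≡b ⟨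
  ⁅ w ⁆ ⊕ ⁅ u ⁆ ≡⟨ ⊕-comm ⁅ w ⁆ ⁅ u ⁆ ⟩
  ⁅ u ⁆ ⊕ ⁅ w ⁆ ∎))
  where
  uw≡wb : ⁅ u ⁆ ⊕ ⁅ a ⁆ ≡ ⁅ w ⁆ ⊕ ⁅ b ⁆
  uw≡wb = ⊕-cancelˡ p (trans (sym (⊕-assoc p ⁅ u ⁆ ⁅ a ⁆)) (trans eq (⊕-assoc p ⁅ w ⁆ ⁅ b ⁆)))
  -- Evaluating both sides at u: the left side contains u, the right side can contain it only through b.
  u≡b : u ≡ b
  u≡b = x∈⁅y⁆⇒x≡y b (lookup⇒[]= u ⁅ b ⁆ (begin
    lookup ⁅ b ⁆ u                   ≡⟨ cong (_xor lookup ⁅ b ⁆ u) (x≢y⇒lookup⁅y⁆x≡false u≢w) ⟨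
    lookup ⁅ w ⁆ u xor lookup ⁅ b ⁆ u ≡⟨ lookup-⊕ ⁅ w ⁆ ⁅ b ⁆ u ⟨
    lookup (⁅ w ⁆ ⊕ ⁅ b ⁆) u          ≡⟨ cong (λ s → lookup s u) uw≡wb ⟨
    lookup (⁅ u ⁆ ⊕ ⁅ a ⁆) u          ≡⟨ lookup-⊕ ⁅ u ⁆ ⁅ a ⁆ u ⟩
    lookup ⁅ u ⁆ u xor lookup ⁅ a ⁆ u ≡⟨ cong₂ _xor_ (lookup⁅x⁆x≡true u) (x≢y⇒lookup⁅y⁆x≡false (a≢u ∘ sym)) ⟩
    true                              ∎))

p⊆q⊕[p∩∁q] : (p q : Subset n) → p ⊆ q ⊕ (p ∩ ∁ q)
p⊆q⊕[p∩∁q] p q {i} i∈p = lookup⇒[]= i _ (begin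
  lookup (q ⊕ (p ∩ ∁ q)) i                     ≡⟨ lookup-⊕ q (p ∩ ∁ q) i ⟩
  lookup q i xor lookup (p ∩ ∁ q) i            ≡⟨ cong (lookup q i xor_) (lookup-zipWith _∧_ i p (∁ q)) ⟩
  lookup q i xor (lookup p i ∧ lookup (∁ q) i) ≡⟨ cong (λ b → lookup q i xor (b ∧ lookup (∁ q) i)) ([]=⇒lookup i∈p) ⟩
  lookup q i xor lookup (∁ q) i                ≡⟨ cong (lookup q i xor_) (lookup-map i not q) ⟩
  lookup q i xor not (lookup q i)              ≡⟨ xor-inverseʳ (lookup q i) ⟩
  true                                         ∎)

lookup-preimage : (e : Fin k → Fin n) (p : Subset n) (i : Fin k) → lookup (preimage e p) i ≡ lookup p (e i)
lookup-preimage e p = lookup∘tabulate (lookup p ∘ e)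

preimage-zipWith : (g : Bool → Bool → Bool) (e : Fin k → Fin n) (p q : Subset n) →
                   preimage e (zipWith g p q) ≡ zipWith g (preimage e p) (preimage e q)
preimage-zipWith g e p q = lookup-injective λ i → begin
  lookup (preimage e (zipWith g p q)) i                 ≡⟨ lookup-preimage e (zipWith g p q) i ⟩
  lookup (zipWith g p q) (e i)                          ≡⟨ lookup-zipWith g (e i) p q ⟩
  g (lookup p (e i)) (lookup q (e i))                   ≡⟨ cong₂ g (lookup-preimage e p i) (lookup-preimage e q i) ⟨
  g (lookup (preimage e p) i) (lookup (preimage e q) i) ≡⟨ lookup-zipWith g i (preimage e p) (preimage e q) ⟨
  lookup (zipWith g (preimage e p) (preimage e q)) i    ∎

preimage-map : (g : Bool → Bool) (e : Fin k → Fin n) (p : Subset n) →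
               preimage e (map g p) ≡ map g (preimage e p)
preimage-map g e p = lookup-injective λ i → begin
  lookup (preimage e (map g p)) i   ≡⟨ lookup-preimage e (map g p) i ⟩
  lookup (map g p) (e i)            ≡⟨ lookup-map (e i) g p ⟩
  g (lookup p (e i))                ≡⟨ cong g (lookup-preimage e p i) ⟨
  g (lookup (preimage e p) i)       ≡⟨ lookup-map i g (preimage e p) ⟨
  lookup (map g (preimage e p)) i   ∎

preimage-⊥ : (e : Fin k → Fin n) → preimage e ⊥ ≡ ⊥
preimage-⊥ e = lookup-injective λ i →
  trans (lookup-preimage e ⊥ i) (trans (lookup-replicate (e i) false) (sym (lookup-replicate i false)))

preimage-⁅⁆ : {e : Fin k → Fin n} → Injective _≡_ _≡_ e → (i : Fin k) → preimage e ⁅ e i ⁆ ≡ ⁅ i ⁆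
preimage-⁅⁆ {e = e} e-inj i = lookup-injective λ j → trans (lookup-preimage e ⁅ e i ⁆ j) (at j)
  where
  at : ∀ j → lookup ⁅ e i ⁆ (e j) ≡ lookup ⁅ i ⁆ j
  at j with j ≟ i
  ... | yes refl = trans (lookup⁅x⁆x≡true (e i)) (sym (lookup⁅x⁆x≡true i))
  ... | no j≢i   = trans (x≢y⇒lookup⁅y⁆x≡false (j≢i ∘ e-inj)) (sym (x≢y⇒lookup⁅y⁆x≡false j≢i))

preimage-⁅⁆-∉ : (e : Fin k → Fin n) {v : Fin n} → (∀ i → e i ≢ v) → preimage e ⁅ v ⁆ ≡ ⊥
preimage-⁅⁆-∉ e {v} v∉e = lookup-injective λ i → begin
  lookup (preimage e ⁅ v ⁆) i ≡⟨ lookup-preimage e ⁅ v ⁆ i ⟩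
  lookup ⁅ v ⁆ (e i)          ≡⟨ x≢y⇒lookup⁅y⁆x≡false (v∉e i) ⟩
  false                       ≡⟨ lookup-replicate i false ⟨
  lookup ⊥ i                  ∎

preimage-inverse : {e : Fin k → Fin n} {h : Fin n → Fin k} → (∀ i → h (e i) ≡ i) →
                   (p : Subset k) → preimage e (preimage h p) ≡ p
preimage-inverse {e = e} {h} h∘e≗id p = lookup-injective λ i → begin
  lookup (preimage e (preimage h p)) i ≡⟨ lookup-preimage e (preimage h p) i ⟩
  lookup (preimage h p) (e i)          ≡⟨ lookup-preimage h p (e i) ⟩
  lookup p (h (e i))                   ≡⟨ cong (lookup p) (h∘e≗id i) ⟩
  lookup p i                           ∎

-- image σ is, by definition, preimage (Inverse.from σ).
module _ (σ : Fin n ↔ Fin k) where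
  open Inverse σ

  image-⁅⁆ : (x : Fin n) → image σ ⁅ x ⁆ ≡ ⁅ to x ⁆
  image-⁅⁆ x = begin
    preimage from ⁅ x ⁆           ≡⟨ cong (preimage from ∘ ⁅_⁆) (strictlyInverseʳ x) ⟨
    preimage from ⁅ from (to x) ⁆ ≡⟨ preimage-⁅⁆ (Injection.injective (↔⇒↣ (↔-sym σ))) (to x) ⟩
    ⁅ to x ⁆                      ∎

  ⊕-image-⊕⁅⁆ : (A : Subset k) (S : Subset n) (z : Fin n) →
                A ⊕ image σ (S ⊕ ⁅ z ⁆) ≡ A ⊕ image σ S ⊕ ⁅ to z ⁆
  ⊕-image-⊕⁅⁆ A S z = begin
    A ⊕ image σ (S ⊕ ⁅ z ⁆)         ≡⟨ cong (A ⊕_) (preimage-zipWith _xor_ from S ⁅ z ⁆) ⟩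
    A ⊕ (image σ S ⊕ image σ ⁅ z ⁆) ≡⟨ cong (λ s → A ⊕ (image σ S ⊕ s)) (image-⁅⁆ z) ⟩
    A ⊕ (image σ S ⊕ ⁅ to z ⁆)      ≡⟨ ⊕-assoc A (image σ S) ⁅ to z ⁆ ⟨
    A ⊕ image σ S ⊕ ⁅ to z ⁆        ∎

injective⇒surjective : {h : Fin n → Fin n} → Injective _≡_ _≡_ h → ∀ j → ∃ λ i → h i ≡ j
injective⇒surjective {suc n} {h} h-inj j with any? (λ i → h i ≟ j)
... | yes hit = hit
... | no miss = contradiction (injective⇒≤ h'-inj) 1+n≰n
  where
  h' : Fin (suc n) → Fin n
  h' i = punchOut {i = j} λ j≡hi → miss (i , sym j≡hi)
  h'-inj : Injective _≡_ _≡_ h'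
  h'-inj {a} {b} eq = h-inj (punchOut-injective (λ q → miss (a , sym q)) (λ q → miss (b , sym q)) eq)

injection⇒↔ : n ≡ k → {h : Fin n → Fin k} → Injective _≡_ _≡_ h →
              Σ (Fin n ↔ Fin k) λ σ → ∀ i → Inverse.to σ i ≡ h i
injection⇒↔ refl {h} h-inj = mk↔ₛ′ h (proj₁ ∘ surj) (proj₂ ∘ surj) (λ i → h-inj (proj₂ (surj (h i)))) , λ _ → refl
  where
  surj : ∀ j → ∃ λ i → h i ≡ j
  surj = injective⇒surjective h-inj

-- Simplicial complexes and isomorphisms of their TAR graphs

Family : ℕ → Set
Family n = Subset n → Bool

Members : Family n → Set
Members {n} P = Σ (Subset n) λ T → P T ≡ true

Members-≡ : {P : Family n} {x y : Members P} → proj₁ x ≡ proj₁ y → x ≡ y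
Members-≡ {x = T , p} {.T , q} refl = cong (T ,_) (Decidable⇒UIP.≡-irrelevant Data.Bool._≟_ p q)

Adjacent : {P : Family n} → Members P → Members P → Set
Adjacent x y = ∣ proj₁ x ⊕ proj₁ y ∣ ≡ 1

PreservesAdjacency : {P : Family n} {P' : Family k} → (Members P → Members P') → Set
PreservesAdjacency g = ∀ x y → Adjacent x y → Adjacent (g x) (g y)

from-preservesAdjacency : {P : Family n} {P' : Family k} (f : Members P ↔ Members P') →
  (∀ x y → Adjacent (Inverse.to f x) (Inverse.to f y) → Adjacent x y) →
  PreservesAdjacency (Inverse.from f)
from-preservesAdjacency f reflects x y x~y =
  reflects (from x) (from y) (subst₂ Adjacent (sym (strictlyInverseˡ x)) (sym (strictlyInverseˡ y)) x~y)
  where open Inverse f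

DownClosed : Family n → Set
DownClosed P = ∀ {S T} → P S ≡ true → T ⊆ S → P T ≡ true

record IsSimplicialComplex (P : Family n) : Set where
  field
    downClosed  : DownClosed P
    empty-face  : P ⊥ ≡ true
    vertex-face : ∀ v → P ⁅ v ⁆ ≡ true

image-closed : {P : Family n} {P' : Family k} → DownClosed P → DownClosed P' →
  (σ : Fin n ↔ Fin k) (A : Subset k) → (∀ {T} → P T ≡ true → P' (A ⊕ image σ T) ≡ true) →
  ∀ {T} → P T ≡ true → P' (image σ T) ≡ true
image-closed {n} P-down P'-down σ A A⊕image∈P' {T} p = P'-down (A⊕image∈P' (P-down p (p∩q⊆p T U⁻))) σT⊆
  where
  open Inverse σ
  U⁻ : Subset n
  U⁻ = ∁ (image (↔-sym σ) A)
  image-U : image σ (T ∩ U⁻) ≡ image σ T ∩ ∁ A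
  image-U = begin
    preimage from (T ∩ U⁻)                        ≡⟨ preimage-zipWith _∧_ from T U⁻ ⟩
    image σ T ∩ preimage from U⁻                  ≡⟨ cong (image σ T ∩_) (preimage-map not from (image (↔-sym σ) A)) ⟩
    image σ T ∩ ∁ (preimage from (preimage to A)) ≡⟨ cong (λ s → image σ T ∩ ∁ s) σσ⁻A≡A ⟩
    image σ T ∩ ∁ A                               ∎
    where
    σσ⁻A≡A : preimage from (preimage to A) ≡ A
    σσ⁻A≡A = preimage-inverse {e = from} {to} strictlyInverseˡ A
  σT⊆ : image σ T ⊆ A ⊕ image σ (T ∩ U⁻)
  σT⊆ = subst (λ S → image σ T ⊆ A ⊕ S) (sym image-U) (p⊆q⊕[p∩∁q] (image σ T) A)

module Relabelling {P : Family n} {P' : Family k} (cx : IsSimplicialComplex P)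
  (f : Members P ↔ Members P') (f-adj : PreservesAdjacency (Inverse.to f)) where

  open IsSimplicialComplex cx
  open Inverse f using (to; from; strictlyInverseˡ)

  F : Members P → Subset k
  F = proj₁ ∘ to

  F-injective : ∀ {x y} → F x ≡ F y → proj₁ x ≡ proj₁ y
  F-injective eq = cong proj₁ (Injection.injective (↔⇒↣ f) (Members-≡ eq))

  origin : Subset k
  origin = F (⊥ , empty-face)

  F-adjacent : ∀ x y {v} → proj₁ x ⊕ proj₁ y ≡ ⁅ v ⁆ → ∃ λ a → F x ≡ F y ⊕ ⁅ a ⁆
  F-adjacent x y {v} x⊕y≡v with ∣p∣≡1⇒p≡⁅x⁆ (f-adj x y (trans (cong ∣_∣ x⊕y≡v) (∣⁅x⁆∣≡1 v)))
  ... | a , Fx⊕Fy≡a = a , p⊕q≡r⇒p≡q⊕r Fx⊕Fy≡a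

  ψ-spec : ∀ v → ∃ λ a → F (⁅ v ⁆ , vertex-face v) ≡ origin ⊕ ⁅ a ⁆
  ψ-spec v = F-adjacent (⁅ v ⁆ , vertex-face v) (⊥ , empty-face) (⊕-identityʳ ⁅ v ⁆)

  ψ : Fin n → Fin k
  ψ v = proj₁ (ψ-spec v)

  ψ-injective : Injective _≡_ _≡_ ψ
  ψ-injective {v} {w} ψv≡ψw = ⁅⁆-injective (F-injective (begin
    F (⁅ v ⁆ , vertex-face v) ≡⟨ proj₂ (ψ-spec v) ⟩
    origin ⊕ ⁅ ψ v ⁆          ≡⟨ cong (λ a → origin ⊕ ⁅ a ⁆) ψv≡ψw ⟩
    origin ⊕ ⁅ ψ w ⁆          ≡⟨ proj₂ (ψ-spec w) ⟨
    F (⁅ w ⁆ , vertex-face w) ∎))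

  module Affine (σ : Fin n ↔ Fin k) (σ≗ψ : ∀ v → Inverse.to σ v ≡ ψ v) where

    F-vertex : ∀ {T} (p : P T ≡ true) x → T ≡ ⁅ x ⁆ → F (T , p) ≡ origin ⊕ image σ T
    F-vertex p x refl = begin
      F (⁅ x ⁆ , p)              ≡⟨ cong F (Members-≡ refl) ⟩
      F (⁅ x ⁆ , vertex-face x)  ≡⟨ proj₂ (ψ-spec x) ⟩
      origin ⊕ ⁅ ψ x ⁆           ≡⟨ cong (λ a → origin ⊕ ⁅ a ⁆) (σ≗ψ x) ⟨
      origin ⊕ ⁅ Inverse.to σ x ⁆ ≡⟨ cong (origin ⊕_) (image-⁅⁆ σ x) ⟨
      origin ⊕ image σ ⁅ x ⁆     ∎

    F-empty : ∀ {T} (p : P T ≡ true) → T ≡ ⊥ → F (T , p) ≡ origin ⊕ image σ T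
    F-empty p refl = begin
      F (⊥ , p)              ≡⟨ cong F (Members-≡ refl) ⟩
      origin                 ≡⟨ ⊕-identityʳ origin ⟨
      origin ⊕ ⊥             ≡⟨ cong (origin ⊕_) (preimage-⊥ (Inverse.from σ)) ⟨
      origin ⊕ image σ ⊥     ∎

    F-remove : ∀ {T x} (p : P T ≡ true) (p₁ : P (T ⊕ ⁅ x ⁆) ≡ true) →
               F (T ⊕ ⁅ x ⁆ , p₁) ≡ origin ⊕ image σ (T ⊕ ⁅ x ⁆) →
               ∃ λ a → F (T , p) ≡ origin ⊕ image σ T ⊕ ⁅ Inverse.to σ x ⁆ ⊕ ⁅ a ⁆
    F-remove {T} {x} p p₁ IH with F-adjacent (T , p) (T ⊕ ⁅ x ⁆ , p₁) (p⊕[p⊕q]≡q T ⁅ x ⁆)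
    ... | a , FT≡ = a , (begin
      F (T , p)                                       ≡⟨ FT≡ ⟩
      F (T ⊕ ⁅ x ⁆ , p₁) ⊕ ⁅ a ⁆                      ≡⟨ cong (_⊕ ⁅ a ⁆) IH ⟩
      origin ⊕ image σ (T ⊕ ⁅ x ⁆) ⊕ ⁅ a ⁆            ≡⟨ cong (_⊕ ⁅ a ⁆) (⊕-image-⊕⁅⁆ σ origin T x) ⟩
      origin ⊕ image σ T ⊕ ⁅ Inverse.to σ x ⁆ ⊕ ⁅ a ⁆ ∎)

    F-exchange : ∀ {T x y} (p : P T ≡ true) → x ∈ T → y ∈ T ⊕ ⁅ x ⁆ →
                 (∀ {S} (q : P S ≡ true) → ∣ S ∣ < ∣ T ∣ → F (S , q) ≡ origin ⊕ image σ S) →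
                 F (T , p) ≡ origin ⊕ image σ T
    F-exchange {T} {x} {y} p x∈T y∈T₁ IH =
      conclude (F-remove p p₁ (IH p₁ ∣T₁∣<∣T∣)) (F-remove p p₂ (IH p₂ (∣p⊕⁅x⁆∣<∣p∣ y∈T)))
      where
      T₁ = T ⊕ ⁅ x ⁆
      T₁⊆T : T₁ ⊆ T
      T₁⊆T = p⊕⁅x⁆⊆p x∈T
      y∈T : y ∈ T
      y∈T = T₁⊆T y∈T₁
      ∣T₁∣<∣T∣ : ∣ T₁ ∣ < ∣ T ∣
      ∣T₁∣<∣T∣ = ∣p⊕⁅x⁆∣<∣p∣ x∈T
      p₁ : P T₁ ≡ true
      p₁ = downClosed p T₁⊆T
      p₂ : P (T ⊕ ⁅ y ⁆) ≡ true
      p₂ = downClosed p (p⊕⁅x⁆⊆p y∈T)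
      p₁₂ : P (T₁ ⊕ ⁅ y ⁆) ≡ true
      p₁₂ = downClosed p₁ (p⊕⁅x⁆⊆p y∈T₁)
      σx≢σy : Inverse.to σ x ≢ Inverse.to σ y
      σx≢σy σx≡σy = x∉p⊕⁅x⁆ x∈T (subst (_∈ T₁) (sym (Injection.injective (↔⇒↣ σ) σx≡σy)) y∈T₁)
      B = origin ⊕ image σ T
      conclude : (∃ λ a → F (T , p) ≡ B ⊕ ⁅ Inverse.to σ x ⁆ ⊕ ⁅ a ⁆) →
                 (∃ λ b → F (T , p) ≡ B ⊕ ⁅ Inverse.to σ y ⁆ ⊕ ⁅ b ⁆) →
                 F (T , p) ≡ B
      conclude (a , FT≡₁) (b , FT≡₂) with a ≟ Inverse.to σ x
      ... | yes refl = trans FT≡₁ ([p⊕q]⊕q≡p B ⁅ a ⁆)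
      -- Otherwise a is ψ y, and then f T = f T₁₂ by the induction hypothesis for T₁₂.
      ... | no a≢σx = contradiction (subst (x ∈_) T≡T₁₂ x∈T) (x∉p⊕⁅x⁆ x∈T ∘ p⊕⁅x⁆⊆p y∈T₁)
        where
        a≡σy : a ≡ Inverse.to σ y
        a≡σy = singleton-exchange B σx≢σy a≢σx (trans (sym FT≡₁) FT≡₂)
        T≡T₁₂ : T ≡ T₁ ⊕ ⁅ y ⁆
        T≡T₁₂ = F-injective {T , p} {T₁ ⊕ ⁅ y ⁆ , p₁₂} (begin
          F (T , p)                                   ≡⟨ FT≡₁ ⟩
          B ⊕ ⁅ Inverse.to σ x ⁆ ⊕ ⁅ a ⁆              ≡⟨ cong (λ c → B ⊕ ⁅ Inverse.to σ x ⁆ ⊕ ⁅ c ⁆) a≡σy ⟩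
          B ⊕ ⁅ Inverse.to σ x ⁆ ⊕ ⁅ Inverse.to σ y ⁆ ≡⟨ cong (_⊕ ⁅ Inverse.to σ y ⁆) (⊕-image-⊕⁅⁆ σ origin T x) ⟨
          origin ⊕ image σ T₁ ⊕ ⁅ Inverse.to σ y ⁆    ≡⟨ ⊕-image-⊕⁅⁆ σ origin T₁ y ⟨
          origin ⊕ image σ (T₁ ⊕ ⁅ y ⁆)               ≡⟨ IH p₁₂ (<-trans (∣p⊕⁅x⁆∣<∣p∣ y∈T₁) ∣T₁∣<∣T∣) ⟨
          F (T₁ ⊕ ⁅ y ⁆ , p₁₂)                        ∎)

    F-affine : ∀ T (p : P T ≡ true) → F (T , p) ≡ origin ⊕ image σ T
    F-affine T p = go T p (<-wellFounded ∣ T ∣)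
      where
      go : ∀ T (p : P T ≡ true) → Acc _<_ ∣ T ∣ → F (T , p) ≡ origin ⊕ image σ T
      go T p (acc rec) with nonempty? T
      ... | no T-empty = F-empty p (Empty-unique T-empty)
      ... | yes (x , x∈T) with nonempty? (T ⊕ ⁅ x ⁆)
      ...   | no T₁-empty = F-vertex p x (p⊕q≡⊥⇒p≡q (Empty-unique T₁-empty))
      ...   | yes (y , y∈T₁) = F-exchange p x∈T y∈T₁ λ q lt → go _ q (rec lt)

    origin⊕image∈P' : ∀ {T} → P T ≡ true → P' (origin ⊕ image σ T) ≡ true
    origin⊕image∈P' {T} p = subst (λ S → P' S ≡ true) (F-affine T p) (proj₂ (to (T , p)))

    inverse-origin⊕image∈P : ∀ {S} → P' S ≡ true → P (image (↔-sym σ) origin ⊕ image (↔-sym σ) S) ≡ true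
    inverse-origin⊕image∈P {S} q = subst (λ R → P R ≡ true) T≡ (proj₂ (from (S , q)))
      where
      open Inverse σ using () renaming (to to σ→; from to σ←; strictlyInverseʳ to σ←∘σ→)
      T = proj₁ (from (S , q))
      σT≡ : image σ T ≡ origin ⊕ S
      σT≡ = begin
        image σ T                     ≡⟨ p⊕[p⊕q]≡q origin (image σ T) ⟨
        origin ⊕ (origin ⊕ image σ T) ≡⟨ cong (origin ⊕_) (F-affine T (proj₂ (from (S , q)))) ⟨
        origin ⊕ F (from (S , q))     ≡⟨ cong (λ x → origin ⊕ proj₁ x) (strictlyInverseˡ (S , q)) ⟩
        origin ⊕ S                    ∎
      T≡ : T ≡ image (↔-sym σ) origin ⊕ image (↔-sym σ) S
      T≡ = begin
        T                                             ≡⟨ preimage-inverse {e = σ→} {σ←} σ←∘σ→ T ⟨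
        preimage σ→ (image σ T)                       ≡⟨ cong (preimage σ→) σT≡ ⟩
        preimage σ→ (origin ⊕ S)                      ≡⟨ preimage-zipWith _xor_ σ→ origin S ⟩
        image (↔-sym σ) origin ⊕ image (↔-sym σ) S   ∎

rigidity : {P : Family n} {P' : Family k} → IsSimplicialComplex P → IsSimplicialComplex P' →
  (f : Members P ↔ Members P') → PreservesAdjacency (Inverse.to f) → PreservesAdjacency (Inverse.from f) →
  n ≡ k × Σ (Fin n ↔ Fin k) (λ σ → ∀ T → P T ≡ P' (image σ T))
rigidity {n} {k} {P} {P'} cx cx' f f-adj f⁻¹-adj = n≡k , σ , λ T → Bool-≡ (forward {T}) (backward T)
  where
  open IsSimplicialComplex cx using (downClosed)
  open IsSimplicialComplex cx' using () renaming (downClosed to downClosed')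
  module R  = Relabelling cx f f-adj
  module R' = Relabelling cx' (↔-sym f) f⁻¹-adj
  n≡k : n ≡ k
  n≡k = cantor-schröder-bernstein R.ψ-injective R'.ψ-injective
  σ : Fin n ↔ Fin k
  σ = proj₁ (injection⇒↔ n≡k R.ψ-injective)
  open R.Affine σ (proj₂ (injection⇒↔ n≡k R.ψ-injective))
  forward : ∀ {T} → P T ≡ true → P' (image σ T) ≡ true
  forward = image-closed downClosed downClosed' σ R.origin origin⊕image∈P'
  backward : ∀ T → P' (image σ T) ≡ true → P T ≡ true
  backward T q = subst (λ S → P S ≡ true) σ⁻σT≡T
    (image-closed downClosed' downClosed (↔-sym σ) (image (↔-sym σ) R.origin) inverse-origin⊕image∈P q)
    where
    σ⁻σT≡T : image (↔-sym σ) (image σ T) ≡ T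
    σ⁻σT≡T = preimage-inverse {e = Inverse.to σ} {Inverse.from σ} (Inverse.strictlyInverseʳ σ) T

-- Y-sets of a graph

module _ {Y : VSP} (R : Robust Y) where
  open Robust R

  ∅-isYSet : ∀ {m} (G : Graph (suc m)) → Y G ⊥ ≡ true
  ∅-isYSet G = subsetCl G (proj₁ (cohesive G)) ⊥ (proj₂ (cohesive G)) ⊥⊆

  K1-vertex-isYSet : YValue Y K1 1 → (H : Graph 1) → Y H ⁅ zero ⁆ ≡ true
  K1-vertex-isYSet ((T , T-isYSet , ∣T∣≡1) , _) H with ∣p∣≡1⇒p≡⁅x⁆ {p = T} ∣T∣≡1
  ... | zero , refl = trans (sym (isoInv K1 H (↔-id (Fin 1)) K1≅H ⁅ zero ⁆)) T-isYSet
    where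
    K1≅H : GraphIso K1 H (↔-id (Fin 1))
    K1≅H zero zero = sym (irrfl H zero)

  component-vertex-isYSet : ∀ {m k} {G : Graph (suc m)} {H : Graph (suc k)} {e : Fin (suc k) → Fin (suc m)} →
    YValue Y K1 1 ⊎ NoIsolated G → IsComponent G H e → ∀ i → Y H ⁅ i ⁆ ≡ true
  component-vertex-isYSet {k = suc _} {H = H} _ (_ , _ , H-connected , _) i = singleton H H-connected i
  component-vertex-isYSet {k = zero} {H = H} (inj₁ Y[K1]≡1) _ zero = K1-vertex-isYSet Y[K1]≡1 H
  component-vertex-isYSet {k = zero} {G = G} {e = e} (inj₂ no-isolated) (_ , _ , _ , closed) zero
    with no-isolated (e zero)
  ... | u , e₀~u with closed zero u e₀~u
  ...   | zero , refl with () ← trans (sym e₀~u) (irrfl G (e zero))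

  vertex-isYSet : ∀ {m} (G : Graph (suc m)) → YValue Y K1 1 ⊎ NoIsolated G → ∀ v → Y G ⁅ v ⁆ ≡ true
  vertex-isYSet G hyp v = proj₂ (compCons G ⁅ v ⁆) on-component
    where
    on-component : ∀ k (H : Graph (suc k)) e → IsComponent G H e → Y H (preimage e ⁅ v ⁆) ≡ true
    on-component k H e comp with any? (λ i → e i ≟ v)
    ... | yes (i , eᵢ≡v) = subst (λ w → Y H (preimage e ⁅ w ⁆) ≡ true) eᵢ≡v
                              (subst (λ S → Y H S ≡ true) (sym (preimage-⁅⁆ (proj₁ comp) i))
                                (component-vertex-isYSet {G = G} {H} {e} hyp comp i))
    ... | no v∉e = subst (λ S → Y H S ≡ true) (sym (preimage-⁅⁆-∉ e λ i eᵢ≡v → v∉e (i , eᵢ≡v))) (∅-isYSet H)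

  ySets-isSimplicialComplex : ∀ {m} (G : Graph (suc m)) → YValue Y K1 1 ⊎ NoIsolated G →
                              IsSimplicialComplex (Y G)
  ySets-isSimplicialComplex G hyp = record
    { downClosed  = λ {S} {T} S-isYSet T⊆S → subsetCl G S T S-isYSet T⊆S
    ; empty-face  = ∅-isYSet G
    ; vertex-face = vertex-isYSet G hyp
    }

theorem8p13 : (Y : VSP) → Robust Y → ∀ {m m'} (G : Graph (suc m)) (G' : Graph (suc m')) →
    TARIsomorphic Y G G' → (YValue Y K1 1 ⊎ (NoIsolated G × NoIsolated G')) →
    (suc m ≡ suc m') × Σ (Fin (suc m) ↔ Fin (suc m')) (λ ψ → ∀ (T : Subset (suc m)) → Y G T ≡ Y G' (image ψ T))
theorem8p13 Y R G G' (f , f-adj) hyp =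
  rigidity (ySets-isSimplicialComplex R G (Sum.map₂ proj₁ hyp))
           (ySets-isSimplicialComplex R G' (Sum.map₂ proj₂ hyp))
           f (λ x y → proj₁ (f-adj x y)) (from-preservesAdjacency f λ x y → proj₂ (f-adj x y))
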